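{- Let $n\ge 2$ be an integer and let $\beta$ be a real number with $0<\beta<(1-1/n)/2$. Then $F_{r,s}(n)$ grows exponentially in $r$ along $s=\beta r$: there exist constants $c>1$ and $K>0$ such that $F_{r,s}(n)\ge Kc^{r}$ for all positive integers $r,s$ with $s=\beta r$.
   Context: $[n]=\{1,\dots,n\}$. An $r$-tuple $a$ of integers is $s$-less than an $r$-tuple $b$, written $a<_sb$, if $a_i<b_i$ for at least $s$ indices $i$. A sequence $a^1,\dots,a^m$ of $r$-tuples is $s$-increasing if $a^i<_sa^j$ whenever $i<j$. $F_{r,s}(n)$ is the greatest length of an $s$-increasing sequence of $r$-tuples with entries in $[n]$.
   Formalization: The parameter β is rational rather than real, and the constants c and K are taken in the rationals. -}

module Defs where

open import Data.Nat using (ℕ; zero; suc; _≤_; _<_)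
open import Data.Nat.Properties using (_<?_)
open import Data.Fin using (Fin; toℕ)
open import Data.List using (length; filter; allFin)
open import Data.Rational using (ℚ; 1ℚ; _*_)
import Data.Rational
import Data.Integer
import Data.Fin

-- r-tuples with entries in [n]; [n] = {1,…,n} is represented by Fin n = {0,…,n-1}
-- (an order-isomorphic shift, which does not affect comparisons).
Tuple : ℕ → ℕ → Set
Tuple r n = Fin r → Fin n

#less : ∀ {r n} → Tuple r n → Tuple r n → ℕ
#less {r} a b = length (filter (λ i → toℕ (a i) <? toℕ (b i)) (allFin r))

_<[_]_ : ∀ {r n} → Tuple r n → ℕ → Tuple r n → Set
a <[ s ] b = s ≤ #less a b

SIncreasing : ∀ {r n m} → ℕ → (Fin m → Tuple r n) → Set
SIncreasing {m = m} s seq = (i j : Fin m) → Data.Fin._<_ i j → seq i <[ s ] seq j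

ℕ→ℚ : ℕ → ℚ
ℕ→ℚ k = Data.Rational._/_ (Data.Integer.+_ k) 1

-- F_{r,s}(n) ≥ x  (x rational): some s-increasing sequence of r-tuples with
-- entries in [n] has length m with x ≤ m.  Since F_{r,s}(n) is the greatest such
-- length, this is exactly the statement F_{r,s}(n) ≥ x.
record F≥ (r s n : ℕ) (x : ℚ) : Set where
  constructor mkF≥
  field
    m    : ℕ
    seq  : Fin m → Tuple r n
    incr : SIncreasing s seq
    big  : Data.Rational._≤_ x (ℕ→ℚ m)

_^ℚ_ : ℚ → ℕ → ℚ
c ^ℚ zero  = 1ℚ
c ^ℚ suc k = c * (c ^ℚ k)

module Submission where

-- Write n = n₁ + 1 and β = p/q. Index the n^k positions of a block by the words y : [k] → [n] and
-- let the block of a letter x ∈ [k] be the tuple y ↦ y(x). For letters x ≠ x′ the block of x is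
-- below the block of x′ at n^(k-2)·C(n,2) positions, a fraction (1 - 1/n)/2 > β of the block, and
-- likewise with x and x′ exchanged. Take a code of words of length T over [k] that pairwise agree
-- in fewer than a = ⌊T/L⌋ letters (k = 4^L, L = n₁q); concatenating the blocks along each code word
-- and padding with zeros to length r gives tuples any two of which satisfy u <_s v in both orders,
-- because two code words disagree in more than T - a letters and the relative loss a/T ≤ 1/L is
-- absorbed by the gap between (1 - 1/n)/2 and β.
-- A greedy (Gilbert–Varshamov) code has at least k^a/2^T ≥ 2^(T+1)/4^L words, and r < (T+1)n^k
-- gives (1 + 1/(2n^k))^r ≤ 2^(T+1), so F_{r,s}(n) ≥ 4^(-L)·(1 + 1/(2n^k))^r.

open import Defs

module Combinatorics where

  open import Data.Nat
  open import Data.Nat.DivMod using (_/_; _%_; m≡m%n+[m/n]*n; m%n<n; m/n*n≤m; m/n≤m)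
  open import Data.Nat.Properties
  open import Data.Fin as Fin using (Fin; zero; suc; _↑ˡ_; _↑ʳ_; combine; remQuot; splitAt; finToFun)
  open import Data.Fin.Properties as Finₚ using (remQuot-combine; splitAt-↑ˡ)
  open import Data.List as List using (List; []; _∷_; length; filter; tabulate; lookup; allFin)
  open import Data.List.Relation.Unary.All as All using (all?)
  open import Data.List.Relation.Unary.All.Properties using (¬All⇒Any¬)
  open import Data.List.Relation.Unary.Any as Any using (Any; here; there)
  open import Data.List.Relation.Unary.Any.Properties using (lookup-index)
  open import Data.List.Relation.Unary.AllPairs using (AllPairs; []; _∷_)
  open import Data.List.Membership.Propositional using (_∈_)
  open import Data.List.Membership.Propositional.Properties using (∈-lookup; ∈-allFin)
  open import Data.Sum using ([_,_]′)
  open import Data.Product using (∃; ∃₂; _×_; _,_; proj₂; uncurry)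
  open import Function using (_∘_; flip; const; id)
  open import Relation.Nullary using (Dec; yes; no; does; ¬_; ¬?; contradiction)
  open import Data.Bool using (if_then_else_)
  open import Relation.Unary using (Pred; Decidable)
  open import Relation.Binary.PropositionalEquality
  open import Relation.Binary using (Rel)
  open import Relation.Binary.Definitions as B using (tri<; tri≈; tri>)
  open import Data.Nat.Tactic.RingSolver using (solve-∀)
  open import Algebra.Properties.CommutativeSemigroup *-commutativeSemigroup
    using (x∙yz≈y∙xz; xy∙z≈y∙xz; x∙yz≈xz∙y; x∙yz≈yx∙z)
  open import Algebra.Properties.Semiring.Sum +-*-semiring
    using (sum; sum-syntax; ∑-distrib-+; ∑-comm; sum-cong-≗; sum-replicate-zero; *-distribˡ-sum; *-distribʳ-sum)

  -- Defined via does, so that the bracket of suc i ≟ suc j (built with map′) reduces to that of i ≟ j.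
  iverson : ∀ {p} {P : Set p} → Dec P → ℕ
  iverson P? = if does P? then 1 else 0

  iverson-yes : ∀ {p} {P : Set p} (P? : Dec P) → P → iverson P? ≡ 1
  iverson-yes (yes _) _  = refl
  iverson-yes (no ¬p) p  = contradiction p ¬p

  iverson-no : ∀ {p} {P : Set p} (P? : Dec P) → ¬ P → iverson P? ≡ 0
  iverson-no (yes p) ¬p = contradiction p ¬p
  iverson-no (no _)  _  = refl

  iverson≤1 : ∀ {p} {P : Set p} (P? : Dec P) → iverson P? ≤ 1
  iverson≤1 (yes _) = ≤-refl
  iverson≤1 (no _)  = z≤n

  iverson+iverson-¬≡1 : ∀ {p} {P : Set p} (P? : Dec P) → iverson P? + iverson (¬? P?) ≡ 1
  iverson+iverson-¬≡1 (yes _) = refl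
  iverson+iverson-¬≡1 (no _)  = refl

  iverson-⇔ : ∀ {p q} {P : Set p} {Q : Set q} (P? : Dec P) (Q? : Dec Q) →
              (P → Q) → (Q → P) → iverson P? ≡ iverson Q?
  iverson-⇔ (yes p) Q? P→Q Q→P = sym (iverson-yes Q? (P→Q p))
  iverson-⇔ (no ¬p) Q? P→Q Q→P = sym (iverson-no Q? (¬p ∘ Q→P))

  sum-const : ∀ m c → ∑[ i < m ] c ≡ m * c
  sum-const zero    c = refl
  sum-const (suc m) c = cong (c +_) (sum-const m c)

  sum-ones : ∀ m → ∑[ i < m ] 1 ≡ m
  sum-ones m = trans (sum-const m 1) (*-identityʳ m)

  sum-mono-≤ : ∀ {m} {f g : Fin m → ℕ} → (∀ i → f i ≤ g i) → sum f ≤ sum g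
  sum-mono-≤ {zero}  f≤g = z≤n
  sum-mono-≤ {suc m} f≤g = +-mono-≤ (f≤g zero) (sum-mono-≤ (f≤g ∘ suc))

  ≤-sum : ∀ {m} (f : Fin m → ℕ) i → f i ≤ sum f
  ≤-sum f zero    = m≤m+n (f zero) _
  ≤-sum f (suc i) = ≤-trans (≤-sum (f ∘ suc) i) (m≤n+m _ (f zero))

  sum-↑ : ∀ m n (f : Fin (m + n) → ℕ) →
          sum f ≡ ∑[ i < m ] f (i ↑ˡ n) + ∑[ j < n ] f (m ↑ʳ j)
  sum-↑ zero    n f = refl
  sum-↑ (suc m) n f = trans (cong (f zero +_) (sum-↑ m n (f ∘ suc))) (sym (+-assoc (f zero) _ _))

  sum-combine : ∀ m n (f : Fin (m * n) → ℕ) → sum f ≡ ∑[ i < m ] ∑[ j < n ] f (combine i j)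
  sum-combine zero    n f = refl
  sum-combine (suc m) n f =
    trans (sum-↑ n (m * n) f) (cong (∑[ j < n ] f (j ↑ˡ (m * n)) +_) (sum-combine m n (f ∘ (n ↑ʳ_))))

  sum-remQuot : ∀ m n (g : Fin m → Fin n → ℕ) →
                ∑[ x < m * n ] uncurry g (remQuot {m} n x) ≡ ∑[ i < m ] ∑[ j < n ] g i j
  sum-remQuot m n g = trans (sum-combine m n (uncurry g ∘ remQuot n))
    (sum-cong-≗ (λ i → sum-cong-≗ (λ j → cong (uncurry g) (remQuot-combine i j))))

  sum-iverson≤ : ∀ {p} m {P : Pred (Fin m) p} (P? : Decidable P) → ∑[ i < m ] iverson (P? i) ≤ m
  sum-iverson≤ zero    P? = z≤n
  sum-iverson≤ (suc m) P? = +-mono-≤ (iverson≤1 (P? zero)) (sum-iverson≤ m (P? ∘ suc))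

  sum-iverson-≟ : ∀ {m} (i : Fin m) → ∑[ j < m ] iverson (j Fin.≟ i) ≡ 1
  sum-iverson-≟ {suc m} zero    = cong suc (sum-replicate-zero m)
  sum-iverson-≟ {suc m} (suc i) = sum-iverson-≟ i

  length-filter-tabulate : ∀ {a p} {A : Set a} {P : Pred A p} (P? : Decidable P) m (f : Fin m → A) →
                           length (filter P? (tabulate f)) ≡ ∑[ i < m ] iverson (P? (f i))
  length-filter-tabulate P? zero    f = refl
  length-filter-tabulate P? (suc m) f with P? (f zero)
  ... | yes _ = cong suc (length-filter-tabulate P? m (f ∘ suc))
  ... | no _  = length-filter-tabulate P? m (f ∘ suc)

  double-counting : ∀ {m M} (f : Fin m → Fin M → ℕ) → (∀ w → ∃ λ i → 1 ≤ f w i) →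
                    m ≤ ∑[ i < M ] ∑[ w < m ] f w i
  double-counting {m} {M} f covered = begin
    m                              ≡⟨ sym (sum-ones m) ⟩
    ∑[ w < m ] 1                   ≤⟨ sum-mono-≤ (λ w → ≤-trans (proj₂ (covered w)) (≤-sum (f w) _)) ⟩
    ∑[ w < m ] ∑[ i < M ] f w i    ≡⟨ ∑-comm f ⟩
    ∑[ i < M ] ∑[ w < m ] f w i    ∎
    where open ≤-Reasoning

  -- Words and agreements

  -- The words of length k over Fin m are enumerated by Fin (m ^ k), so that they can be summed over.
  word : ∀ m k → Fin (m ^ k) → Fin k → Fin m
  word m k = finToFun

  module _ (k : ℕ) where

    agreement : ∀ T → Fin (k ^ T) → Fin (k ^ T) → ℕ
    agreement T u v = ∑[ t < T ] iverson (word k T u t Finₚ.≟ word k T v t)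

    agreement-refl : ∀ T w → agreement T w w ≡ T
    agreement-refl T w =
      trans (sum-cong-≗ {T} (λ t → iverson-yes (word k T w t Finₚ.≟ word k T w t) refl)) (sum-ones T)

    disagreement : ∀ T → Fin (k ^ T) → Fin (k ^ T) → ℕ
    disagreement T u v = ∑[ t < T ] iverson (¬? (word k T u t Finₚ.≟ word k T v t))

    agreement+disagreement : ∀ T u v → agreement T u v + disagreement T u v ≡ T
    agreement+disagreement T u v = begin
      agreement T u v + disagreement T u v
        ≡⟨ sym (∑-distrib-+ (λ t → iverson (d t)) (λ t → iverson (¬? (d t)))) ⟩
      ∑[ t < T ] (iverson (d t) + iverson (¬? (d t)))
        ≡⟨ sum-cong-≗ {T} (λ t → iverson+iverson-¬≡1 (d t)) ⟩
      ∑[ t < T ] 1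
        ≡⟨ sum-ones T ⟩
      T ∎
      where
      open ≡-Reasoning
      d : ∀ t → Dec (word k T u t ≡ word k T v t)
      d t = word k T u t Finₚ.≟ word k T v t

    agreement<⇒T<disagreement+a : ∀ T u v {a} → agreement T u v < a → suc T ≤ disagreement T u v + a
    agreement<⇒T<disagreement+a T u v {a} agreement<a = begin
      suc T                       ≡⟨ cong suc (sym (agreement+disagreement T u v)) ⟩
      suc (agreement T u v + D)   ≡⟨ cong suc (+-comm (agreement T u v) D) ⟩
      suc (D + agreement T u v)   ≡⟨ sym (+-suc D _) ⟩
      D + suc (agreement T u v)   ≤⟨ +-monoʳ-≤ D agreement<a ⟩
      D + a                       ∎
      where
      open ≤-Reasoning
      D = disagreement T u v

    #agreeing : ∀ T → ℕ → Fin (k ^ T) → ℕ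
    #agreeing T a c = ∑[ w < k ^ T ] iverson (a ≤? agreement T w c)

    #agreeing-suc : ∀ T a c →
                    #agreeing (suc T) (suc a) c ≤ #agreeing T a (Fin.remainder {k} (k ^ T) c) +
                                                  k * #agreeing T (suc a) (Fin.remainder {k} (k ^ T) c)
    #agreeing-suc T a c = begin
      #agreeing (suc T) (suc a) c
        ≡⟨ sum-remQuot k (k ^ T) (λ d w → iverson (suc a ≤? iverson (d Finₚ.≟ c₀) + agreement T w c′)) ⟩
      ∑[ d < k ] ∑[ w < k ^ T ] iverson (suc a ≤? iverson (d Finₚ.≟ c₀) + agreement T w c′)
        ≤⟨ sum-mono-≤ split ⟩
      ∑[ d < k ] (iverson (d Finₚ.≟ c₀) * A + B)
        ≡⟨ ∑-distrib-+ (λ d → iverson (d Finₚ.≟ c₀) * A) (λ _ → B) ⟩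
      ∑[ d < k ] (iverson (d Finₚ.≟ c₀) * A) + ∑[ d < k ] B
        ≡⟨ cong₂ _+_ (sym (*-distribʳ-sum A (λ d → iverson (d Finₚ.≟ c₀)))) (sum-const k B) ⟩
      ∑[ d < k ] iverson (d Finₚ.≟ c₀) * A + k * B
        ≡⟨ cong (λ x → x * A + k * B) (sum-iverson-≟ c₀) ⟩
      1 * A + k * B
        ≡⟨ cong (_+ k * B) (*-identityˡ A) ⟩
      A + k * B ∎
      where
      open ≤-Reasoning
      c₀ = Fin.quotient (k ^ T) c
      c′ = Fin.remainder {k} (k ^ T) c
      A = #agreeing T a c′
      B = #agreeing T (suc a) c′
      split : ∀ d → ∑[ w < k ^ T ] iverson (suc a ≤? iverson (d Finₚ.≟ c₀) + agreement T w c′) ≤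
                    iverson (d Finₚ.≟ c₀) * A + B
      split d with d Finₚ.≟ c₀
      ... | no _  = ≤-refl
      ... | yes _ = begin
        ∑[ w < k ^ T ] iverson (suc a ≤? suc (agreement T w c′))
          ≡⟨ sum-cong-≗ {k ^ T} (λ w → iverson-⇔ (suc a ≤? suc (agreement T w c′)) (a ≤? agreement T w c′)
                                                  s≤s⁻¹ s≤s) ⟩
        A     ≡⟨ sym (+-identityʳ A) ⟩
        1 * A ≤⟨ m≤m+n (1 * A) B ⟩
        1 * A + B ∎

    -- The Hamming-ball bound #agreeing ≤ 2^T k^(T-a), multiplied out: so stated it also holds for
    -- a > T, which lets the induction step go through without a case split on a ≤ T.
    #agreeing-bound : ∀ T a c → k ^ a * #agreeing T a c ≤ 2 ^ T * k ^ T
    #agreeing-bound zero    zero    c = ≤-refl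
    #agreeing-bound zero    (suc a) c = ≤-trans (≤-reflexive (*-zeroʳ (k ^ suc a))) z≤n
    #agreeing-bound (suc T) zero    c = begin
      1 * #agreeing (suc T) zero c ≡⟨ *-identityˡ _ ⟩
      #agreeing (suc T) zero c     ≤⟨ sum-iverson≤ (k ^ suc T) (λ w → zero ≤? agreement (suc T) w c) ⟩
      k ^ suc T                    ≤⟨ m≤n*m (k ^ suc T) (2 ^ suc T) {{m^n≢0 2 (suc T)}} ⟩
      2 ^ suc T * k ^ suc T        ∎
      where open ≤-Reasoning
    #agreeing-bound (suc T) (suc a) c = begin
      k ^ suc a * #agreeing (suc T) (suc a) c
        ≤⟨ *-monoʳ-≤ (k ^ suc a) (#agreeing-suc T a c) ⟩
      k ^ suc a * (A + k * B)
        ≡⟨ spread k (k ^ a) A B ⟩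
      k * (k ^ a * A) + k * (k ^ suc a * B)
        ≤⟨ +-mono-≤ (*-monoʳ-≤ k (#agreeing-bound T a c′)) (*-monoʳ-≤ k (#agreeing-bound T (suc a) c′)) ⟩
      k * (2 ^ T * k ^ T) + k * (2 ^ T * k ^ T)
        ≡⟨ double k (2 ^ T) (k ^ T) ⟩
      2 ^ suc T * k ^ suc T ∎
      where
      open ≤-Reasoning
      c′ = Fin.remainder {k} (k ^ T) c
      A = #agreeing T a c′
      B = #agreeing T (suc a) c′
      spread : ∀ k x A B → k * x * (A + k * B) ≡ k * (x * A) + k * (k * x * B)
      spread = solve-∀
      double : ∀ k x y → k * (x * y) + k * (x * y) ≡ 2 * x * (k * y)
      double = solve-∀

  -- Greedy codes

  module Greedy {a ℓ} {A : Set a} {R : Rel A ℓ} (R? : B.Decidable R) where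

    greedy : List A → List A → List A
    greedy chosen []       = chosen
    greedy chosen (x ∷ xs) with all? (R? x) chosen
    ... | yes _ = greedy (x ∷ chosen) xs
    ... | no _  = greedy chosen xs

    greedy-allPairs : ∀ {chosen} xs → AllPairs R chosen → AllPairs R (greedy chosen xs)
    greedy-allPairs         []       rs = rs
    greedy-allPairs {chosen} (x ∷ xs) rs with all? (R? x) chosen
    ... | yes rx = greedy-allPairs xs (rx ∷ rs)
    ... | no _   = greedy-allPairs xs rs

    greedy-keeps : ∀ {p} {P : A → Set p} {chosen} xs → Any P chosen → Any P (greedy chosen xs)
    greedy-keeps         []       p = p
    greedy-keeps {chosen = chosen} (x ∷ xs) p with all? (R? x) chosen
    ... | yes _ = greedy-keeps xs (there p)
    ... | no _  = greedy-keeps xs p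

    greedy-covers : (∀ x → ¬ R x x) → ∀ {x} chosen xs → x ∈ xs → Any (¬_ ∘ R x) (greedy chosen xs)
    greedy-covers irrefl chosen (y ∷ xs) x∈ with all? (R? y) chosen | x∈
    ... | yes _  | here refl = greedy-keeps xs (here (irrefl y))
    ... | no ¬ry | here refl = greedy-keeps xs (¬All⇒Any¬ (R? y) chosen ¬ry)
    ... | yes _  | there x∈xs = greedy-covers irrefl (y ∷ chosen) xs x∈xs
    ... | no _   | there x∈xs = greedy-covers irrefl chosen xs x∈xs

  allPairs-lookup : ∀ {a ℓ} {A : Set a} {R : Rel A ℓ} {xs : List A} → AllPairs R xs →
                    ∀ {i j} → i Fin.< j → R (lookup xs i) (lookup xs j)
  allPairs-lookup (rx ∷ _)  {zero}  {suc j} _       = All.lookup rx (∈-lookup j)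
  allPairs-lookup (_ ∷ rxs) {suc i} {suc j} (s≤s i<j) = allPairs-lookup rxs i<j

  module _ (k T a : ℕ) .{{_ : NonZero k}} (a≤T : a ≤ T) where

    Separated : Rel (Fin (k ^ T)) _
    Separated u v = agreement k T u v < a

    open Greedy {R = Separated} (λ u v → agreement k T u v <? a)

    code : List (Fin (k ^ T))
    code = greedy [] (allFin (k ^ T))

    code-separated : AllPairs Separated code
    code-separated = greedy-allPairs (allFin (k ^ T)) []

    code-size : k ^ a ≤ length code * 2 ^ T
    code-size = *-cancelʳ-≤ (k ^ a) (length code * 2 ^ T) (k ^ T) {{m^n≢0 k T}} (begin
      k ^ a * k ^ T
        ≤⟨ *-monoʳ-≤ (k ^ a) (double-counting (λ w i → iverson (a ≤? agreement k T w (lookup code i))) covered) ⟩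
      k ^ a * ∑[ i < length code ] #agreeing k T a (lookup code i)
        ≡⟨ *-distribˡ-sum (k ^ a) (λ i → #agreeing k T a (lookup code i)) ⟩
      ∑[ i < length code ] (k ^ a * #agreeing k T a (lookup code i))
        ≤⟨ sum-mono-≤ (λ i → #agreeing-bound k T a (lookup code i)) ⟩
      ∑[ i < length code ] (2 ^ T * k ^ T)
        ≡⟨ trans (sum-const (length code) _) (sym (*-assoc (length code) (2 ^ T) (k ^ T))) ⟩
      length code * 2 ^ T * k ^ T ∎)
      where
      open ≤-Reasoning
      near : ∀ w → Any (¬_ ∘ Separated w) code
      near w = greedy-covers (λ u → ≤⇒≯ (subst (a ≤_) (sym (agreement-refl k T u)) a≤T))
                             [] (allFin (k ^ T)) (∈-allFin w)
      covered : ∀ w → ∃ λ i → 1 ≤ iverson (a ≤? agreement k T w (lookup code i))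
      covered w = Any.index (near w) , ≤-reflexive (sym (iverson-yes (a ≤? _) (≮⇒≥ (lookup-index (near w)))))

  #increasingPairs : ℕ → ℕ
  #increasingPairs n = ∑[ d < n ] ∑[ e < n ] iverson (d Finₚ.<? e)

  iverson-trichotomy : ∀ {n} (d e : Fin n) →
                       iverson (d Finₚ.<? e) + iverson (e Finₚ.<? d) + iverson (e Finₚ.≟ d) ≡ 1
  iverson-trichotomy d e with Finₚ.<-cmp d e
  ... | tri< d<e d≢e _   rewrite iverson-yes (d Finₚ.<? e) d<e | iverson-no (e Finₚ.<? d) (<⇒≯ d<e)
                               | iverson-no (e Finₚ.≟ d) (d≢e ∘ sym) = refl
  ... | tri≈ _ refl _    rewrite iverson-no (d Finₚ.<? d) (n≮n _) | iverson-yes (d Finₚ.≟ d) refl = refl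
  ... | tri> _ d≢e e<d   rewrite iverson-no (d Finₚ.<? e) (<⇒≯ e<d) | iverson-yes (e Finₚ.<? d) e<d
                               | iverson-no (e Finₚ.≟ d) (d≢e ∘ sym) = refl

  #increasingPairs-double : ∀ n → #increasingPairs n + #increasingPairs n + n ≡ n * n
  #increasingPairs-double n = begin
    P + P + n
      ≡⟨ cong₂ (λ x y → P + x + y) (∑-comm lt) (sym diagonal) ⟩
    ∑[ d < n ] ∑[ e < n ] lt d e + ∑[ d < n ] ∑[ e < n ] lt e d + ∑[ d < n ] ∑[ e < n ] eq e d
      ≡⟨ sym (∑∑-distrib-+₃ (λ d e → lt d e) (λ d e → lt e d) (λ d e → eq e d)) ⟩
    ∑[ d < n ] ∑[ e < n ] (lt d e + lt e d + eq e d)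
      ≡⟨ sum-cong-≗ {n} (λ d → sum-cong-≗ {n} (iverson-trichotomy d)) ⟩
    ∑[ d < n ] ∑[ e < n ] 1
      ≡⟨ trans (sum-cong-≗ {n} (λ _ → sum-ones n)) (sum-const n n) ⟩
    n * n ∎
    where
    open ≡-Reasoning
    P = #increasingPairs n
    lt eq : Fin n → Fin n → ℕ
    lt d e = iverson (d Finₚ.<? e)
    eq e d = iverson (e Finₚ.≟ d)
    diagonal : ∑[ d < n ] ∑[ e < n ] eq e d ≡ n
    diagonal = trans (sum-cong-≗ {n} sum-iverson-≟) (sum-ones n)
    ∑-distrib-+₃ : (f g h : Fin n → ℕ) → ∑[ e < n ] (f e + g e + h e) ≡ sum f + sum g + sum h
    ∑-distrib-+₃ f g h = trans (∑-distrib-+ (λ e → f e + g e) h) (cong (_+ sum h) (∑-distrib-+ f g))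
    ∑∑-distrib-+₃ : (f g h : Fin n → Fin n → ℕ) →
      ∑[ d < n ] ∑[ e < n ] (f d e + g d e + h d e) ≡
      ∑[ d < n ] ∑[ e < n ] f d e + ∑[ d < n ] ∑[ e < n ] g d e + ∑[ d < n ] ∑[ e < n ] h d e
    ∑∑-distrib-+₃ f g h = trans (sum-cong-≗ {n} (λ d → ∑-distrib-+₃ (f d) (g d) (h d)))
                                (∑-distrib-+₃ (sum ∘ f) (sum ∘ g) (sum ∘ h))

  module _ (n : ℕ) where

    sum-coordinate : ∀ k (j : Fin k) (g : Fin n → ℕ) →
                     n * ∑[ y < n ^ k ] g (word n k y j) ≡ n ^ k * sum g
    sum-coordinate (suc k) zero g = begin
      n * ∑[ y < n ^ suc k ] g (word n (suc k) y zero)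
        ≡⟨ cong (n *_) (sum-remQuot n (n ^ k) (λ d _ → g d)) ⟩
      n * ∑[ d < n ] ∑[ _ < n ^ k ] g d
        ≡⟨ cong (n *_) (sum-cong-≗ {n} (λ d → sum-const (n ^ k) (g d))) ⟩
      n * ∑[ d < n ] (n ^ k * g d)
        ≡⟨ cong (n *_) (sym (*-distribˡ-sum (n ^ k) g)) ⟩
      n * (n ^ k * sum g)
        ≡⟨ sym (*-assoc n (n ^ k) _) ⟩
      n * n ^ k * sum g ∎
      where open ≡-Reasoning
    sum-coordinate (suc k) (suc j) g = begin
      n * ∑[ y < n ^ suc k ] g (word n (suc k) y (suc j))
        ≡⟨ cong (n *_) (sum-remQuot n (n ^ k) (λ _ y → g (word n k y j))) ⟩
      n * ∑[ _ < n ] ∑[ y < n ^ k ] g (word n k y j)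
        ≡⟨ cong (n *_) (sum-const n (∑[ y < n ^ k ] g (word n k y j))) ⟩
      n * (n * ∑[ y < n ^ k ] g (word n k y j))
        ≡⟨ cong (n *_) (sum-coordinate k j g) ⟩
      n * (n ^ k * sum g)
        ≡⟨ sym (*-assoc n (n ^ k) _) ⟩
      n * n ^ k * sum g ∎
      where open ≡-Reasoning

    sum-coordinatePair : ∀ k (i j : Fin k) → i ≢ j → (h : Fin n → Fin n → ℕ) →
                         n * n * ∑[ y < n ^ k ] h (word n k y i) (word n k y j) ≡
                         n ^ k * ∑[ d < n ] ∑[ e < n ] h d e
    sum-coordinatePair (suc k) zero zero i≢j h = contradiction refl i≢j
    sum-coordinatePair (suc k) zero (suc j) _ h = begin
      n * n * ∑[ y < n ^ suc k ] h (word n (suc k) y zero) (word n (suc k) y (suc j))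
        ≡⟨ cong (n * n *_) (sum-remQuot n (n ^ k) (λ d y → h d (word n k y j))) ⟩
      n * n * ∑[ d < n ] ∑[ y < n ^ k ] h d (word n k y j)
        ≡⟨ trans (*-assoc n n _) (cong (n *_) (*-distribˡ-sum n (λ d → ∑[ y < n ^ k ] h d (word n k y j)))) ⟩
      n * ∑[ d < n ] (n * ∑[ y < n ^ k ] h d (word n k y j))
        ≡⟨ cong (n *_) (sum-cong-≗ {n} (λ d → sum-coordinate k j (h d))) ⟩
      n * ∑[ d < n ] (n ^ k * ∑[ e < n ] h d e)
        ≡⟨ cong (n *_) (sym (*-distribˡ-sum (n ^ k) (λ d → ∑[ e < n ] h d e))) ⟩
      n * (n ^ k * ∑[ d < n ] ∑[ e < n ] h d e)
        ≡⟨ sym (*-assoc n (n ^ k) _) ⟩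
      n * n ^ k * ∑[ d < n ] ∑[ e < n ] h d e ∎
      where open ≡-Reasoning
    sum-coordinatePair (suc k) (suc i) zero _ h =
      trans (sum-coordinatePair (suc k) zero (suc i) (λ ()) (flip h)) (cong (n ^ suc k *_) (∑-comm (flip h)))
    sum-coordinatePair (suc k) (suc i) (suc j) i≢j h = begin
      n * n * ∑[ y < n ^ suc k ] h (word n (suc k) y (suc i)) (word n (suc k) y (suc j))
        ≡⟨ cong (n * n *_) (sum-remQuot n (n ^ k) (λ _ y → h (word n k y i) (word n k y j))) ⟩
      n * n * ∑[ _ < n ] ∑[ y < n ^ k ] h (word n k y i) (word n k y j)
        ≡⟨ cong (n * n *_) (sum-const n (∑[ y < n ^ k ] h (word n k y i) (word n k y j))) ⟩
      n * n * (n * ∑[ y < n ^ k ] h (word n k y i) (word n k y j))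
        ≡⟨ x∙yz≈y∙xz (n * n) n _ ⟩
      n * (n * n * ∑[ y < n ^ k ] h (word n k y i) (word n k y j))
        ≡⟨ cong (n *_) (sum-coordinatePair k i j (i≢j ∘ cong suc) h) ⟩
      n * (n ^ k * ∑[ d < n ] ∑[ e < n ] h d e)
        ≡⟨ sym (*-assoc n (n ^ k) _) ⟩
      n * n ^ k * ∑[ d < n ] ∑[ e < n ] h d e ∎
      where open ≡-Reasoning

  -- Tuples built from blocks

  #less≡∑ : ∀ {r n} (a b : Tuple r n) → #less a b ≡ ∑[ i < r ] iverson (a i Finₚ.<? b i)
  #less≡∑ {r} a b = length-filter-tabulate (λ i → a i Finₚ.<? b i) r id

  pad : ∀ {m n₁} e → Tuple m (suc n₁) → Tuple (m + e) (suc n₁)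
  pad {m} e a x = [ a , const zero ]′ (splitAt m x)

  #less-pad : ∀ {m n₁} e (a b : Tuple m (suc n₁)) → #less a b ≤ #less (pad e a) (pad e b)
  #less-pad {m} e a b = begin
    #less a b
      ≡⟨ #less≡∑ a b ⟩
    ∑[ i < m ] iverson (a i Finₚ.<? b i)
      ≡⟨ sum-cong-≗ {m} (λ i → cong₂ (λ x y → iverson (x Finₚ.<? y)) (padded a i) (padded b i)) ⟩
    ∑[ i < m ] iverson (pad e a (i ↑ˡ e) Finₚ.<? pad e b (i ↑ˡ e))
      ≤⟨ m≤m+n _ _ ⟩
    ∑[ i < m ] iverson (pad e a (i ↑ˡ e) Finₚ.<? pad e b (i ↑ˡ e)) +
    ∑[ j < e ] iverson (pad e a (m ↑ʳ j) Finₚ.<? pad e b (m ↑ʳ j))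
      ≡⟨ sym (sum-↑ m e (λ x → iverson (pad e a x Finₚ.<? pad e b x))) ⟩
    ∑[ x < m + e ] iverson (pad e a x Finₚ.<? pad e b x)
      ≡⟨ sym (#less≡∑ (pad e a) (pad e b)) ⟩
    #less (pad e a) (pad e b) ∎
    where
    open ≤-Reasoning
    padded : ∀ c i → c i ≡ pad e c (i ↑ˡ e)
    padded c i = sym (cong [ c , const zero ]′ (splitAt-↑ˡ m i e))

  module Blocks (n : ℕ) where

    block : ∀ k → Fin k → Tuple (n ^ k) n
    block k x y = word n k y x

    concatBlocks : ∀ k T → Fin (k ^ T) → Tuple (T * n ^ k) n
    concatBlocks k T c x = uncurry (λ t → block k (word k T c t)) (remQuot (n ^ k) x)

    #less-block : ∀ k {x y : Fin k} → x ≢ y →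
                  n * n * #less (block k x) (block k y) ≡ n ^ k * #increasingPairs n
    #less-block k {x} {y} x≢y = trans (cong (n * n *_) (#less≡∑ (block k x) (block k y)))
                                      (sum-coordinatePair n k x y x≢y (λ d e → iverson (d Finₚ.<? e)))

    #less-concatBlocks : ∀ k T u v → #less (concatBlocks k T u) (concatBlocks k T v) ≡
                         ∑[ t < T ] #less (block k (word k T u t)) (block k (word k T v t))
    #less-concatBlocks k T u v = begin
      #less (concatBlocks k T u) (concatBlocks k T v)
        ≡⟨ #less≡∑ (concatBlocks k T u) (concatBlocks k T v) ⟩
      ∑[ x < T * n ^ k ] iverson (concatBlocks k T u x Finₚ.<? concatBlocks k T v x)
        ≡⟨ sum-remQuot T (n ^ k) (λ t y → iverson (block k (word k T u t) y Finₚ.<? block k (word k T v t) y)) ⟩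
      ∑[ t < T ] ∑[ y < n ^ k ] iverson (block k (word k T u t) y Finₚ.<? block k (word k T v t) y)
        ≡⟨ sum-cong-≗ {T} (λ t → sym (#less≡∑ (block k (word k T u t)) (block k (word k T v t)))) ⟩
      ∑[ t < T ] #less (block k (word k T u t)) (block k (word k T v t)) ∎
      where open ≡-Reasoning

    disagreement-#less : ∀ k T u v → disagreement k T u v * (n ^ k * #increasingPairs n) ≤
                                     n * n * #less (concatBlocks k T u) (concatBlocks k T v)
    disagreement-#less k T u v = begin
      disagreement k T u v * W
        ≡⟨ *-distribʳ-sum W (λ t → iverson (¬? (word k T u t Finₚ.≟ word k T v t))) ⟩
      ∑[ t < T ] (iverson (¬? (word k T u t Finₚ.≟ word k T v t)) * W)
        ≤⟨ sum-mono-≤ (λ t → blockwise (word k T u t) (word k T v t)) ⟩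
      ∑[ t < T ] (n * n * #less (block k (word k T u t)) (block k (word k T v t)))
        ≡⟨ sym (*-distribˡ-sum (n * n) (λ t → #less (block k (word k T u t)) (block k (word k T v t)))) ⟩
      n * n * ∑[ t < T ] #less (block k (word k T u t)) (block k (word k T v t))
        ≡⟨ cong (n * n *_) (sym (#less-concatBlocks k T u v)) ⟩
      n * n * #less (concatBlocks k T u) (concatBlocks k T v) ∎
      where
      open ≤-Reasoning
      W = n ^ k * #increasingPairs n
      blockwise : ∀ x y → iverson (¬? (x Finₚ.≟ y)) * W ≤ n * n * #less (block k x) (block k y)
      blockwise x y with x Finₚ.≟ y
      ... | yes _   = z≤n
      ... | no x≢y  = ≤-reflexive (trans (+-identityʳ W) (sym (#less-block k x≢y)))

  [1+N]^m*d≤N^[1+m] : ∀ N m d → m + d ≡ N → suc N ^ m * d ≤ N ^ suc m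
  [1+N]^m*d≤N^[1+m] N zero    d m+d≡N = ≤-reflexive (trans (+-identityʳ d) (trans m+d≡N (sym (*-identityʳ N))))
  [1+N]^m*d≤N^[1+m] N (suc m) d m+d≡N = begin
    suc N * suc N ^ m * d
      ≡⟨ xy∙z≈y∙xz (suc N) (suc N ^ m) d ⟩
    suc N ^ m * (suc N * d)
      ≤⟨ *-monoʳ-≤ (suc N ^ m) (≤-trans (+-monoˡ-≤ (N * d) d≤N) (≤-reflexive (sym (*-suc N d)))) ⟩
    suc N ^ m * (N * suc d)
      ≡⟨ x∙yz≈y∙xz (suc N ^ m) N (suc d) ⟩
    N * (suc N ^ m * suc d)
      ≤⟨ *-monoʳ-≤ N ([1+N]^m*d≤N^[1+m] N m (suc d) (trans (+-suc m d) m+d≡N)) ⟩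
    N * N ^ suc m ∎
    where
    open ≤-Reasoning
    d≤N : d ≤ N
    d≤N = subst (d ≤_) m+d≡N (m≤n+m d (suc m))

  [1+2r]^m≤2*[2r]^m : ∀ r .{{_ : NonZero r}} m → m ≤ r → suc (2 * r) ^ m ≤ 2 * (2 * r) ^ m
  [1+2r]^m≤2*[2r]^m r m m≤r = *-cancelʳ-≤ (suc (2 * r) ^ m) (2 * (2 * r) ^ m) r (begin
    suc (2 * r) ^ m * r
      ≤⟨ *-monoʳ-≤ (suc (2 * r) ^ m) r≤2r∸m ⟩
    suc (2 * r) ^ m * (2 * r ∸ m)
      ≤⟨ [1+N]^m*d≤N^[1+m] (2 * r) m (2 * r ∸ m) (m+[n∸m]≡n (≤-trans m≤r (m≤n*m r 2))) ⟩
    2 * r * (2 * r) ^ m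
      ≡⟨ trans (*-assoc 2 r _) (x∙yz≈xz∙y 2 r _) ⟩
    2 * (2 * r) ^ m * r ∎)
    where
    open ≤-Reasoning
    r≤2r∸m : r ≤ 2 * r ∸ m
    r≤2r∸m = ≤-trans (≤-reflexive (sym (trans (m+n∸m≡n r (r + 0)) (+-identityʳ r)))) (∸-monoʳ-≤ (2 * r) m≤r)

  [1+2r]^m≤2^j*[2r]^m : ∀ r .{{_ : NonZero r}} j m → m ≤ j * r → suc (2 * r) ^ m ≤ 2 ^ j * (2 * r) ^ m
  [1+2r]^m≤2^j*[2r]^m r zero    m m≤0 rewrite n≤0⇒n≡0 m≤0 = ≤-refl
  [1+2r]^m≤2^j*[2r]^m r (suc j) m m≤[1+j]r = begin
    suc N ^ m                                     ≡⟨ cong (suc N ^_) (sym split) ⟩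
    suc N ^ (r ⊓ m + (m ∸ r))                     ≡⟨ ^-distribˡ-+-* (suc N) (r ⊓ m) (m ∸ r) ⟩
    suc N ^ (r ⊓ m) * suc N ^ (m ∸ r)             ≤⟨ *-mono-≤ ([1+2r]^m≤2*[2r]^m r (r ⊓ m) (m⊓n≤m r m))
                                                              ([1+2r]^m≤2^j*[2r]^m r j (m ∸ r) m∸r≤jr) ⟩
    2 * N ^ (r ⊓ m) * (2 ^ j * N ^ (m ∸ r))       ≡⟨ [m*n]*[o*p]≡[m*o]*[n*p] 2 (N ^ (r ⊓ m)) (2 ^ j) _ ⟩
    2 * 2 ^ j * (N ^ (r ⊓ m) * N ^ (m ∸ r))       ≡⟨ cong (2 ^ suc j *_) (sym (^-distribˡ-+-* N (r ⊓ m) (m ∸ r))) ⟩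
    2 ^ suc j * N ^ (r ⊓ m + (m ∸ r))             ≡⟨ cong (λ x → 2 ^ suc j * N ^ x) split ⟩
    2 ^ suc j * N ^ m                             ∎
    where
    open ≤-Reasoning
    N = 2 * r
    split : r ⊓ m + (m ∸ r) ≡ m
    split = m⊓n+n∸m≡n r m
    m∸r≤jr : m ∸ r ≤ j * r
    m∸r≤jr = ≤-trans (∸-monoˡ-≤ r m≤[1+j]r) (≤-reflexive (m+n∸m≡n r (j * r)))

  x*[1+T]≤L*D : ∀ x L T D a → x < L → suc T ≤ D + a → a * L ≤ T → x * suc T ≤ L * D
  x*[1+T]≤L*D x L T D a x<L T<D+a aL≤T = +-cancelʳ-≤ (suc T) (x * suc T) (L * D) (begin
    x * suc T + suc T   ≡⟨ +-comm (x * suc T) (suc T) ⟩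
    suc x * suc T       ≤⟨ *-monoˡ-≤ (suc T) x<L ⟩
    L * suc T           ≤⟨ *-monoʳ-≤ L T<D+a ⟩
    L * (D + a)         ≡⟨ *-distribˡ-+ L D a ⟩
    L * D + L * a       ≤⟨ +-monoʳ-≤ (L * D) (≤-trans (≤-reflexive (*-comm L a)) (≤-trans aL≤T (n≤1+n T))) ⟩
    L * D + suc T       ∎)
    where open ≤-Reasoning

  4^m≡2^m*2^m : ∀ m → 4 ^ m ≡ 2 ^ m * 2 ^ m
  4^m≡2^m*2^m zero    = refl
  4^m≡2^m*2^m (suc m) = trans (cong (4 *_) (4^m≡2^m*2^m m)) (regroup (2 ^ m))
    where
    regroup : ∀ x → 4 * (x * x) ≡ 2 * x * (2 * x)
    regroup = solve-∀

  2^[1+T]≤M*4^L : ∀ L M T a → suc T ≤ L + a * L → (4 ^ L) ^ a ≤ M * 2 ^ T → 2 ^ suc T ≤ M * 4 ^ L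
  2^[1+T]≤M*4^L L M T a T<L+aL code≥ =
    *-cancelʳ-≤ (2 ^ suc T) (M * 4 ^ L) (2 ^ suc T) {{m^n≢0 2 (suc T)}} (begin
    2 ^ suc T * 2 ^ suc T      ≡⟨ sym (4^m≡2^m*2^m (suc T)) ⟩
    4 ^ suc T                  ≤⟨ ^-monoʳ-≤ 4 T<L+aL ⟩
    4 ^ (L + a * L)            ≡⟨ trans (^-distribˡ-+-* 4 L (a * L)) (cong (λ x → 4 ^ L * 4 ^ x) (*-comm a L)) ⟩
    4 ^ L * 4 ^ (L * a)        ≡⟨ cong (4 ^ L *_) (sym (^-*-assoc 4 L a)) ⟩
    4 ^ L * (4 ^ L) ^ a        ≤⟨ *-monoʳ-≤ (4 ^ L) code≥ ⟩
    4 ^ L * (M * 2 ^ T)        ≤⟨ *-monoʳ-≤ (4 ^ L) (*-monoʳ-≤ M (m≤m+n (2 ^ T) (2 ^ T + 0))) ⟩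
    4 ^ L * (M * 2 ^ suc T)    ≡⟨ x∙yz≈yx∙z (4 ^ L) M _ ⟩
    M * 4 ^ L * 2 ^ suc T      ∎)
    where open ≤-Reasoning

  n*n*s≤D*[r₀*P] : ∀ n₁ p q s r T r₀ D P .{{_ : NonZero q}} →
                   P + P + suc n₁ ≡ suc n₁ * suc n₁ → s * q ≡ p * r → r ≤ suc T * r₀ →
                   2 * suc n₁ * p * suc T ≤ n₁ * q * D → suc n₁ * suc n₁ * s ≤ D * (r₀ * P)
  n*n*s≤D*[r₀*P] n₁ p q s r T r₀ D P 2P+n≡n² sq≡pr r≤ separated =
    *-cancelˡ-≤ (2 * q) {{m*n≢0 2 q}} (begin
      2 * q * (n * n * s)           ≡⟨ l₁ q n s ⟩
      2 * n * n * (s * q)           ≡⟨ cong (2 * n * n *_) sq≡pr ⟩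
      2 * n * n * (p * r)           ≤⟨ *-monoʳ-≤ (2 * n * n) (*-monoʳ-≤ p r≤) ⟩
      2 * n * n * (p * (suc T * r₀)) ≡⟨ l₂ n p (suc T) r₀ ⟩
      n * r₀ * (2 * n * p * suc T)  ≤⟨ *-monoʳ-≤ (n * r₀) separated ⟩
      n * r₀ * (n₁ * q * D)         ≡⟨ l₃ n r₀ n₁ q D ⟩
      q * D * r₀ * (n * n₁)         ≡⟨ cong (q * D * r₀ *_) (sym 2P≡nn₁) ⟩
      q * D * r₀ * (P + P)          ≡⟨ l₄ q D r₀ P ⟩
      2 * q * (D * (r₀ * P))        ∎)
    where
    open ≤-Reasoning
    n = suc n₁
    2P≡nn₁ : P + P ≡ n * n₁
    2P≡nn₁ = +-cancelʳ-≡ n (P + P) (n * n₁) (trans 2P+n≡n² (trans (*-suc n n₁) (+-comm n (n * n₁))))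
    l₁ : ∀ q n s → 2 * q * (n * n * s) ≡ 2 * n * n * (s * q)
    l₁ = solve-∀
    l₂ : ∀ n p t r₀ → 2 * n * n * (p * (t * r₀)) ≡ n * r₀ * (2 * n * p * t)
    l₂ = solve-∀
    l₃ : ∀ n r₀ n₁ q D → n * r₀ * (n₁ * q * D) ≡ q * D * r₀ * (n * n₁)
    l₃ = solve-∀
    l₄ : ∀ q D r₀ P → q * D * r₀ * (P + P) ≡ 2 * q * (D * (r₀ * P))
    l₄ = solve-∀

  module Construction (n₁ p q : ℕ) .{{_ : NonZero q}} (2np<n₁q : 2 * suc n₁ * p < n₁ * q) where

    n L k r₀ : ℕ
    n  = suc n₁
    L  = n₁ * q
    k  = 4 ^ L
    r₀ = n ^ k

    instance
      L≢0 : NonZero L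
      L≢0 = >-nonZero (≤-trans (s≤s z≤n) 2np<n₁q)
      k≢0 : NonZero k
      k≢0 = m^n≢0 4 L
      r₀≢0 : NonZero r₀
      r₀≢0 = m^n≢0 n k

    LongSequence : ℕ → ℕ → Set
    LongSequence r s = ∃₂ λ M (seq : Fin M → Tuple r n) →
                       SIncreasing s seq × suc (2 * r₀) ^ r ≤ M * 4 ^ L * (2 * r₀) ^ r

    open Blocks n

    build : ∀ T e r s → r ≡ T * r₀ + e → e < r₀ → s * q ≡ p * r → LongSequence r s
    build T e .(T * r₀ + e) s refl e<r₀ sq≡pr = length G , seq , increasing , long
      where
      a = T / L
      G = code k T a (m/n≤m T L)
      seq : Fin (length G) → Tuple (T * r₀ + e) n
      seq i = pad e (concatBlocks k T (lookup G i))
      r≤[1+T]r₀ : T * r₀ + e ≤ suc T * r₀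
      r≤[1+T]r₀ = ≤-trans (+-monoʳ-≤ (T * r₀) (<⇒≤ e<r₀)) (≤-reflexive (+-comm (T * r₀) r₀))
      increasing : SIncreasing s seq
      increasing i j i<j = *-cancelˡ-≤ (n * n) (begin
        n * n * s
          ≤⟨ n*n*s≤D*[r₀*P] n₁ p q s _ T r₀ D (#increasingPairs n) (#increasingPairs-double n) sq≡pr r≤[1+T]r₀
               (x*[1+T]≤L*D (2 * n * p) L T D a 2np<n₁q T<D+a (m/n*n≤m T L)) ⟩
        D * (r₀ * #increasingPairs n)
          ≤⟨ disagreement-#less k T u v ⟩
        n * n * #less (concatBlocks k T u) (concatBlocks k T v)
          ≤⟨ *-monoʳ-≤ (n * n) (#less-pad e (concatBlocks k T u) (concatBlocks k T v)) ⟩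
        n * n * #less (seq i) (seq j) ∎)
        where
        open ≤-Reasoning
        u = lookup G i
        v = lookup G j
        D = disagreement k T u v
        T<D+a : suc T ≤ D + a
        T<D+a = agreement<⇒T<disagreement+a k T u v (allPairs-lookup (code-separated k T a (m/n≤m T L)) i<j)
      long : suc (2 * r₀) ^ (T * r₀ + e) ≤ length G * 4 ^ L * (2 * r₀) ^ (T * r₀ + e)
      long = ≤-trans ([1+2r]^m≤2^j*[2r]^m r₀ (suc T) _ r≤[1+T]r₀)
                     (*-monoˡ-≤ _ (2^[1+T]≤M*4^L L (length G) T a T<L+aL (code-size k T a (m/n≤m T L))))
        where
        T<L+aL : suc T ≤ L + a * L
        T<L+aL = ≤-trans (≤-reflexive (cong suc (m≡m%n+[m/n]*n T L))) (+-monoˡ-≤ (a * L) (m%n<n T L))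

    long-sIncreasing : ∀ r s → s * q ≡ p * r → LongSequence r s
    long-sIncreasing r s = build (r / r₀) (r % r₀) r s
      (trans (m≡m%n+[m/n]*n r r₀) (+-comm (r % r₀) _)) (m%n<n r r₀)


-- Passing to rationals

open import Data.Nat using (ℕ; _≤_; NonZero)
open import Data.Product using (Σ; _×_)
open import Relation.Binary.PropositionalEquality using (_≡_)
open import Data.Integer using (+_)
open import Data.Rational using (ℚ; 0ℚ; 1ℚ; _<_; _-_; _*_; _/_; ½)

open import Data.Nat as ℕ using (zero; suc)
import Data.Nat.Properties as ℕ
open import Data.Nat.Coprimality using (Coprime)
open import Data.Nat.Tactic.RingSolver using (solve-∀)
open import Data.Integer as ℤ using (-[1+_])
import Data.Integer.Properties as ℤ
open import Data.Rational as ℚ using (mkℚ; toℚᵘ)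
import Data.Rational.Properties as ℚ
open import Data.Rational.Unnormalised as ℚᵘ using (mkℚᵘ; *≡*; *≤*; *<*; _≃_)
import Data.Rational.Unnormalised.Properties as ℚᵘ
open import Data.Product using (_,_)
open import Relation.Binary.PropositionalEquality using (refl; sym; trans; cong; subst; subst₂; module ≡-Reasoning)

toℚᵘ-/ : ∀ i n .{{_ : NonZero n}} → toℚᵘ (i / n) ≃ i ℚᵘ./ n
toℚᵘ-/ i (suc n) = ℚ.toℚᵘ-fromℚᵘ (mkℚᵘ i n)

/-*-/ : ∀ i m j n .{{_ : NonZero m}} .{{_ : NonZero n}} →
        (i ℚᵘ./ m) ℚᵘ.* (j ℚᵘ./ n) ≃ ((i ℤ.* j) ℚᵘ./ (m ℕ.* n)) {{ℕ.m*n≢0 m n}}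
/-*-/ i (suc m) j (suc n) = ℚᵘ.≃-refl

toℚᵘ-^ℚ : ∀ A B .{{_ : NonZero B}} r → toℚᵘ ((+ A / B) ^ℚ r) ≃ (+ (A ℕ.^ r) ℚᵘ./ B ℕ.^ r) {{ℕ.m^n≢0 B r}}
toℚᵘ-^ℚ A B zero    = ℚᵘ.≃-refl
toℚᵘ-^ℚ A B (suc r) = begin-equality
  toℚᵘ (+ A / B ℚ.* (+ A / B) ^ℚ r)                  ≃⟨ ℚ.toℚᵘ-homo-* (+ A / B) ((+ A / B) ^ℚ r) ⟩
  toℚᵘ (+ A / B) ℚᵘ.* toℚᵘ ((+ A / B) ^ℚ r)          ≃⟨ ℚᵘ.*-cong (toℚᵘ-/ (+ A) B) (toℚᵘ-^ℚ A B r) ⟩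
  (+ A ℚᵘ./ B) ℚᵘ.* (+ (A ℕ.^ r) ℚᵘ./ B ℕ.^ r)       ≃⟨ /-*-/ (+ A) B (+ (A ℕ.^ r)) (B ℕ.^ r) ⟩
  (+ A ℤ.* + (A ℕ.^ r)) ℚᵘ./ (B ℕ.^ suc r)           ≡⟨ cong (ℚᵘ._/ (B ℕ.^ suc r)) (sym (ℤ.pos-* A (A ℕ.^ r))) ⟩
  + (A ℕ.^ suc r) ℚᵘ./ (B ℕ.^ suc r)                 ∎
  where
  open ℚᵘ.≤-Reasoning
  instance
    B^r≢0 : NonZero (B ℕ.^ r)
    B^r≢0 = ℕ.m^n≢0 B r
    B^[1+r]≢0 : NonZero (B ℕ.^ suc r)
    B^[1+r]≢0 = ℕ.m^n≢0 B (suc r)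

/-≤-/1 : ∀ a b c .{{_ : NonZero b}} → a ℕ.≤ c ℕ.* b → (+ a ℚᵘ./ b) ℚᵘ.≤ (+ c ℚᵘ./ 1)
/-≤-/1 a (suc b) c a≤cb =
  *≤* (subst₂ ℤ._≤_ (ℤ.pos-* a 1) (ℤ.pos-* c (suc b))
              (ℤ.+≤+ (ℕ.≤-trans (ℕ.≤-reflexive (ℕ.*-identityʳ a)) a≤cb)))

1<[1+N]/N : ∀ N .{{_ : NonZero N}} → 1ℚ ℚ.< + suc N / N
1<[1+N]/N (suc N) = ℚ.toℚᵘ-cancel-< (ℚᵘ.<-respʳ-≃ (ℚᵘ.≃-sym (toℚᵘ-/ (+ suc (suc N)) (suc N)))
  (*<* (ℤ.+<+ (ℕ.≤-reflexive (cong suc (trans (ℕ.*-identityˡ _) (sym (ℕ.*-identityʳ _))))))))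

0<1/N : ∀ N .{{_ : NonZero N}} → 0ℚ ℚ.< + 1 / N
0<1/N (suc N) = ℚ.toℚᵘ-cancel-< (ℚᵘ.<-respʳ-≃ (ℚᵘ.≃-sym (toℚᵘ-/ (+ 1) (suc N))) (*<* (ℤ.+<+ (ℕ.s≤s ℕ.z≤n))))

[1/D]*[A/B]^r≤M : ∀ A B D M r .{{_ : NonZero B}} .{{_ : NonZero D}} → A ℕ.^ r ℕ.≤ M ℕ.* D ℕ.* B ℕ.^ r →
             (+ 1 / D) ℚ.* (+ A / B) ^ℚ r ℚ.≤ ℕ→ℚ M
[1/D]*[A/B]^r≤M A B D M r A^r≤MDB^r = ℚ.toℚᵘ-cancel-≤ (begin
  toℚᵘ ((+ 1 / D) ℚ.* (+ A / B) ^ℚ r)          ≃⟨ ℚ.toℚᵘ-homo-* (+ 1 / D) ((+ A / B) ^ℚ r) ⟩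
  toℚᵘ (+ 1 / D) ℚᵘ.* toℚᵘ ((+ A / B) ^ℚ r)    ≃⟨ ℚᵘ.*-cong (toℚᵘ-/ (+ 1) D) (toℚᵘ-^ℚ A B r) ⟩
  (+ 1 ℚᵘ./ D) ℚᵘ.* (+ (A ℕ.^ r) ℚᵘ./ B ℕ.^ r) ≃⟨ /-*-/ (+ 1) D (+ (A ℕ.^ r)) (B ℕ.^ r) ⟩
  (+ 1 ℤ.* + (A ℕ.^ r)) ℚᵘ./ (D ℕ.* B ℕ.^ r)   ≡⟨ cong (ℚᵘ._/ (D ℕ.* B ℕ.^ r)) (ℤ.*-identityˡ (+ (A ℕ.^ r))) ⟩
  + (A ℕ.^ r) ℚᵘ./ (D ℕ.* B ℕ.^ r)             ≤⟨ /-≤-/1 (A ℕ.^ r) (D ℕ.* B ℕ.^ r) M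
                                                     (ℕ.≤-trans A^r≤MDB^r (ℕ.≤-reflexive (ℕ.*-assoc M D _))) ⟩
  + M ℚᵘ./ 1                                   ≃⟨ ℚᵘ.≃-sym (toℚᵘ-/ (+ M) 1) ⟩
  toℚᵘ (ℕ→ℚ M)                                 ∎)
  where
  open ℚᵘ.≤-Reasoning
  instance
    B^r≢0 : NonZero (B ℕ.^ r)
    B^r≢0 = ℕ.m^n≢0 B r
    DB^r≢0 : NonZero (D ℕ.* B ℕ.^ r)
    DB^r≢0 = ℕ.m*n≢0 D (B ℕ.^ r)

[1-1/n]/2≃[n-1]/2n : ∀ n₁ → toℚᵘ ((1ℚ ℚ.- + 1 / suc n₁) ℚ.* ½) ≃ + n₁ ℚᵘ./ (2 ℕ.* suc n₁)
[1-1/n]/2≃[n-1]/2n n₁ = begin-equality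
  toℚᵘ ((1ℚ ℚ.- + 1 / suc n₁) ℚ.* ½)
    ≃⟨ ℚ.toℚᵘ-homo-* (1ℚ ℚ.- + 1 / suc n₁) ½ ⟩
  toℚᵘ (1ℚ ℚ.- + 1 / suc n₁) ℚᵘ.* ℚᵘ.½
    ≃⟨ ℚᵘ.*-congʳ (ℚᵘ.≃-trans (ℚ.toℚᵘ-homo-+ 1ℚ (ℚ.- (+ 1 / suc n₁)))
                    (ℚᵘ.+-congʳ ℚᵘ.1ℚᵘ (ℚᵘ.≃-trans (ℚ.toℚᵘ-homo‿- (+ 1 / suc n₁))
                                                     (ℚᵘ.-‿cong (toℚᵘ-/ (+ 1) (suc n₁)))))) ⟩
  (ℚᵘ.1ℚᵘ ℚᵘ.- (+ 1 ℚᵘ./ suc n₁)) ℚᵘ.* ℚᵘ.½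
    ≃⟨ *≡* (trans (cong (ℤ._* + (2 ℕ.* suc n₁)) numerator) (cong (+ n₁ ℤ.*_) (sym denominator))) ⟩
  + n₁ ℚᵘ./ (2 ℕ.* suc n₁) ∎
  where
  open ℚᵘ.≤-Reasoning
  numerator : ℚᵘ.↥ ((ℚᵘ.1ℚᵘ ℚᵘ.- (+ 1 ℚᵘ./ suc n₁)) ℚᵘ.* ℚᵘ.½) ≡ + n₁
  numerator = trans (ℤ.+◃n≡+n _) (cong +_ (trans (ℕ.*-identityʳ _) (ℕ.+-identityʳ n₁)))
  denominator : ℚᵘ.↧ ((ℚᵘ.1ℚᵘ ℚᵘ.- (+ 1 ℚᵘ./ suc n₁)) ℚᵘ.* ℚᵘ.½) ≡ + (2 ℕ.* suc n₁)
  denominator = cong +_ (regroup n₁)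
    where
    regroup : ∀ n → suc (suc ((n ℕ.+ 0) ℕ.* 2)) ≡ 2 ℕ.* suc n
    regroup = solve-∀

p/q<[1-1/n]/2⇒2np<[n-1]q : ∀ n₁ p d .{c : Coprime p (suc d)} →
                           mkℚ (+ p) d c ℚ.< (1ℚ ℚ.- + 1 / suc n₁) ℚ.* ½ → 2 ℕ.* suc n₁ ℕ.* p ℕ.< n₁ ℕ.* suc d
p/q<[1-1/n]/2⇒2np<[n-1]q n₁ p d β<
  with ℚᵘ.<-respʳ-≃ ([1-1/n]/2≃[n-1]/2n n₁) (ℚ.toℚᵘ-mono-< β<)
... | *<* pq<n₁q = subst (ℕ._< n₁ ℕ.* suc d) (ℕ.*-comm p (2 ℕ.* suc n₁))
                     (ℤ.drop‿+<+ (subst₂ ℤ._<_ (sym (ℤ.pos-* p _)) (sym (ℤ.pos-* n₁ (suc d))) pq<n₁q))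

s≡[p/q]*r⇒s*q≡p*r : ∀ s p d r .{c : Coprime p (suc d)} →
                    ℕ→ℚ s ≡ mkℚ (+ p) d c ℚ.* ℕ→ℚ r → s ℕ.* suc d ≡ p ℕ.* r
s≡[p/q]*r⇒s*q≡p*r s p d r {c} s≡βr with begin-equality
    + s ℚᵘ./ 1                              ≃⟨ ℚᵘ.≃-sym (toℚᵘ-/ (+ s) 1) ⟩
    toℚᵘ (ℕ→ℚ s)                            ≃⟨ ℚ.toℚᵘ-cong s≡βr ⟩
    toℚᵘ (mkℚ (+ p) d c ℚ.* ℕ→ℚ r)          ≃⟨ ℚ.toℚᵘ-homo-* (mkℚ (+ p) d c) (ℕ→ℚ r) ⟩
    mkℚᵘ (+ p) d ℚᵘ.* toℚᵘ (ℕ→ℚ r)          ≃⟨ ℚᵘ.*-congˡ (toℚᵘ-/ (+ r) 1) ⟩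
    mkℚᵘ (+ p) d ℚᵘ.* (+ r ℚᵘ./ 1)          ∎
  where open ℚᵘ.≤-Reasoning
... | *≡* eq = ℤ.+-injective (begin
  + (s ℕ.* suc d)            ≡⟨ ℤ.pos-* s (suc d) ⟩
  + s ℤ.* + suc d            ≡⟨ cong (λ x → + s ℤ.* + x) (sym (ℕ.*-identityʳ (suc d))) ⟩
  + s ℤ.* + (suc d ℕ.* 1)    ≡⟨ eq ⟩
  + p ℤ.* + r ℤ.* + 1        ≡⟨ ℤ.*-identityʳ _ ⟩
  + p ℤ.* + r                ≡⟨ sym (ℤ.pos-* p r) ⟩
  + (p ℕ.* r)                ∎)
  where open ≡-Reasoning

lemma5p1 : (n : ℕ) → .{{_ : NonZero n}} → 2 ≤ n →
    (β : ℚ) → 0ℚ < β → β < (1ℚ - + 1 / n) * ½ →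
    Σ ℚ λ c → Σ ℚ λ K → 1ℚ < c × 0ℚ < K ×
      ((r s : ℕ) → 1 ≤ r → 1 ≤ s → ℕ→ℚ s ≡ β * ℕ→ℚ r → F≥ r s n (K * (c ^ℚ r)))
lemma5p1 (suc n₁) _ (mkℚ -[1+ _ ] _ _) 0<β _ with ℚ.toℚᵘ-mono-< 0<β
... | *<* ()
lemma5p1 (suc n₁) _ (mkℚ (+ p) d _) _ β<[1-1/n]/2 =
  + suc N / N , + 1 / 4 ℕ.^ L , 1<[1+N]/N N , 0<1/N (4 ℕ.^ L) , sequences
  where
  open Combinatorics.Construction n₁ p (suc d) (p/q<[1-1/n]/2⇒2np<[n-1]q n₁ p d β<[1-1/n]/2)
  N : ℕ
  N = 2 ℕ.* r₀
  instance
    N≢0 : NonZero N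
    N≢0 = ℕ.m*n≢0 2 r₀
    4^L≢0 : NonZero (4 ℕ.^ L)
    4^L≢0 = ℕ.m^n≢0 4 L
  sequences : (r s : ℕ) → 1 ≤ r → 1 ≤ s → ℕ→ℚ s ≡ mkℚ (+ p) d _ * ℕ→ℚ r →
              F≥ r s (suc n₁) (+ 1 / 4 ℕ.^ L * (+ suc N / N) ^ℚ r)
  sequences r s _ _ s≡βr with long-sIncreasing r s (s≡[p/q]*r⇒s*q≡p*r s p d r s≡βr)
  ... | M , seq , increasing , long = mkF≥ M seq increasing ([1/D]*[A/B]^r≤M (suc N) N (4 ℕ.^ L) M r long)
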